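{- Let $p$ be a prime, $\tau_0:=\lfloor (p-3)/3\rfloor$, and let $A=\{a_1,\dots,a_q\}\subseteq\mathbb{Z}_p\setminus\{0\}$ be a set of $q$ distinct elements with the property that whenever $\alpha_1b_1+\alpha_2b_2+\alpha_3b_3\equiv0\pmod p$ for some $b_1,b_2,b_3\in A$ and integers $\alpha_1,\alpha_2,\alpha_3$ with $|\alpha_i|\le4$, then $\alpha_1+\alpha_2+\alpha_3=0$ and $b_i=b_j$ for all $i,j\in[3]$ with $\alpha_i,\alpha_j\ne0$. On the vertex set $W=\{w_i: i\in\mathbb{Z}_p\setminus\{0\}\}$, for $a\in\mathbb{Z}_p\setminus\{0\}$ and $i\in[\tau_0]$ let $H^a_i$ be the complete graph on $\{w_{a(3i-2)},w_{a(3i-1)},w_{a(3i)},w_{a(3i+1)},w_{a(3i+2)}\}$ (indices mod $p$), and for $j\in[q]$ let $G^j:=\bigcup_{i\in[\tau_0]}H^{a_j}_i$. Then the graphs $G^j$, $j\in[q]$, are pairwise edge-disjoint. -}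

module Defs where

open import Data.Nat as ℕ using (ℕ; _∸_; _/_)
open import Data.Integer using (ℤ; +_; _+_; _-_; _*_; -_; _≤_; _<_; ∣_∣)
open import Data.Integer.Divisibility using (_∣_)
open import Data.Product using (∃; ∃-syntax; _×_; Σ-syntax)
open import Data.Sum using (_⊎_)
open import Data.Fin using (Fin)
open import Relation.Binary.PropositionalEquality using (_≡_; _≢_)
open import Relation.Nullary using (¬_)

-- congruence modulo a natural number p (elements of ℤ_p are represented by integers)
infix 4 _≡_[mod_]
_≡_[mod_] : ℤ → ℤ → ℕ → Set
x ≡ y [mod p ] = (+ p) ∣ (x - y)

τ₀ : ℕ → ℕ
τ₀ p = (p ∸ 3) / 3

Offset : ℤ → Set
Offset s = (- (+ 2)) ≤ s × s ≤ + 2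

-- u and v are (residues mod p of) vertex indices forming an edge w_u w_v of the
-- complete graph H^a_i on {w_{a(3i-2)}, …, w_{a(3i+2)}} (indices mod p)
EdgeH : (p : ℕ) (a : ℤ) (i : ℕ) (u v : ℤ) → Set
EdgeH p a i u v =
  ¬ (u ≡ v [mod p ]) ×
  ∃[ s ] ∃[ t ] (Offset s × Offset t ×
     u ≡ a * ((+ 3) * (+ i) + s) [mod p ] ×
     v ≡ a * ((+ 3) * (+ i) + t) [mod p ])

EdgeG : (p : ℕ) (a : ℤ) (u v : ℤ) → Set
EdgeG p a u v = ∃[ i ] (1 ℕ.≤ i × i ℕ.≤ τ₀ p × EdgeH p a i u v)

GoodSet : (p q : ℕ) (a : Fin q → ℤ) → Set
GoodSet p q a =
  ∀ (j₁ j₂ j₃ : Fin q) (α₁ α₂ α₃ : ℤ) →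
  ∣ α₁ ∣ ℕ.≤ 4 → ∣ α₂ ∣ ℕ.≤ 4 → ∣ α₃ ∣ ℕ.≤ 4 →
  α₁ * a j₁ + α₂ * a j₂ + α₃ * a j₃ ≡ + 0 [mod p ] →
  (α₁ + α₂ + α₃ ≡ + 0) ×
  (α₁ ≢ + 0 → α₂ ≢ + 0 → a j₁ ≡ a j₂ [mod p ]) ×
  (α₁ ≢ + 0 → α₃ ≢ + 0 → a j₁ ≡ a j₃ [mod p ]) ×
  (α₂ ≢ + 0 → α₃ ≢ + 0 → a j₂ ≡ a j₃ [mod p ])

-- If w_u w_v is an edge of H^a_i, then u ≡ a(3i+s) and v ≡ a(3i+t) with offsets
-- s, t ∈ {−2,…,2}, so u − v ≡ aδ for δ = s − t, where |δ| ≤ 4 and δ ≠ 0 since u ≢ v.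
-- An edge shared by G^j and G^k therefore yields δ a_j − δ′ a_k ≡ 0 with both
-- coefficients nonzero, and the additive property of A forces a_j ≡ a_k.
module Submission where

open import Defs
open import Data.Nat using (ℕ; suc; s≤s; z≤n)
import Data.Nat as ℕ
import Data.Nat.Properties as ℕ
open import Data.Nat.Primality using (Prime)
open import Data.Integer using (ℤ; +_; -[1+_]; +≤+; -≤-; _≤_; _<_; _+_; _-_; _*_; -_; ∣_∣)
open import Data.Integer.Properties using (∣i-j∣≤∣i∣+∣j∣; ∣-i∣≡∣i∣; neg-injective)
open import Data.Integer.Divisibility.Signed using (_∣_; ∣ᵤ⇒∣; ∣⇒∣ᵤ; ∣m⇒∣-m; ∣m∣n⇒∣m+n; ∣m∣n⇒∣m-n)
open import Data.Integer.Tactic.RingSolver using (solve-∀)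
open import Data.Fin using (Fin)
open import Data.Product using (∃-syntax; _×_; _,_; proj₁; proj₂)
open import Relation.Binary.PropositionalEquality using (_≢_; _≡_; refl; subst; sym)
open import Relation.Nullary using (¬_)

-n≤i≤n⇒∣i∣≤n : ∀ {n i} → - (+ n) ≤ i → i ≤ + n → ∣ i ∣ ℕ.≤ n
-n≤i≤n⇒∣i∣≤n {i = + m}               _         (+≤+ m≤n) = m≤n
-n≤i≤n⇒∣i∣≤n {suc n} {i = -[1+ m ]} (-≤- m≤n) _         = s≤s m≤n

offset-difference-bounded : ∀ {s t} → Offset s → Offset t → ∣ s - t ∣ ℕ.≤ 4
offset-difference-bounded {s} {t} (-2≤s , s≤2) (-2≤t , t≤2) =
  ℕ.≤-trans (∣i-j∣≤∣i∣+∣j∣ s t) (ℕ.+-mono-≤ (-n≤i≤n⇒∣i∣≤n -2≤s s≤2) (-n≤i≤n⇒∣i∣≤n -2≤t t≤2))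

module Congruence (p : ℕ) where

  -- _≡_[mod p ] unfolds to divisibility of absolute values in ℕ, from which Agda cannot
  -- infer its two sides; this record can be.
  infix 4 _≈_
  record _≈_ (x y : ℤ) : Set where
    constructor by-divisibility
    field divides : + p ∣ x - y

  open _≈_

  SmallMultiple : ℤ → ℤ → Set
  SmallMultiple a x = ∃[ δ ] (∣ δ ∣ ℕ.≤ 4 × δ ≢ + 0 × x ≈ a * δ)

  from-mod : ∀ x y → x ≡ y [mod p ] → x ≈ y
  from-mod x y x≡y = by-divisibility (∣ᵤ⇒∣ x≡y)

  to-mod : ∀ x y → x ≈ y → x ≡ y [mod p ]
  to-mod x y (by-divisibility p∣x-y) = ∣⇒∣ᵤ p∣x-y

  divides-rearranged : ∀ {z x y} → z ≡ x - y → + p ∣ z → x ≈ y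
  divides-rearranged refl = by-divisibility

  ≈-sym : ∀ {x y} → x ≈ y → y ≈ x
  ≈-sym {x} {y} (by-divisibility p∣x-y) = divides-rearranged (identity x y) (∣m⇒∣-m p∣x-y)
    where
    identity : ∀ x y → - (x - y) ≡ y - x
    identity = solve-∀

  ≈-trans : ∀ {x y z} → x ≈ y → y ≈ z → x ≈ z
  ≈-trans {x} {y} {z} (by-divisibility p∣x-y) (by-divisibility p∣y-z) =
    divides-rearranged (identity x y z) (∣m∣n⇒∣m+n p∣x-y p∣y-z)
    where
    identity : ∀ x y z → (x - y) + (y - z) ≡ x - z
    identity = solve-∀

  ≈-sub : ∀ {x x′ y y′} → x ≈ x′ → y ≈ y′ → x - y ≈ x′ - y′
  ≈-sub {x} {x′} {y} {y′} (by-divisibility p∣x-x′) (by-divisibility p∣y-y′) =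
    divides-rearranged (identity x x′ y y′) (∣m∣n⇒∣m-n p∣x-x′ p∣y-y′)
    where
    identity : ∀ x x′ y y′ → (x - x′) - (y - y′) ≡ (x - y) - (x′ - y′)
    identity = solve-∀

  edgeH-difference : ∀ a i u v → EdgeH p a i u v → SmallMultiple a (u - v)
  edgeH-difference a i u v (u≢v , s , t , offset-s , offset-t , u≡ , v≡) =
    s - t , offset-difference-bounded offset-s offset-t , δ≢0 , u-v≈aδ
    where
    c : ℤ
    c = + 3 * + i
    factor : ∀ a c s t → a * (c + s) - a * (c + t) ≡ a * (s - t)
    factor = solve-∀
    u-v≈aδ : u - v ≈ a * (s - t)
    u-v≈aδ = subst (u - v ≈_) (factor a c s t)
               (≈-sub (from-mod u (a * (c + s)) u≡) (from-mod v (a * (c + t)) v≡))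
    cancel-zero-multiple : ∀ a u v → (u - v) - a * + 0 ≡ u - v
    cancel-zero-multiple = solve-∀
    δ≢0 : s - t ≢ + 0
    δ≢0 δ≡0 = u≢v (to-mod u v (divides-rearranged (cancel-zero-multiple a u v)
                                  (divides (subst (λ δ → u - v ≈ a * δ) δ≡0 u-v≈aδ))))

  edgeG-difference : ∀ a u v → EdgeG p a u v → SmallMultiple a (u - v)
  edgeG-difference a u v (i , _ , _ , edge) = edgeH-difference a i u v edge

  good-set-multiples-congruent : ∀ {q a} → GoodSet p q a → ∀ j k {δ δ′} →
    ∣ δ ∣ ℕ.≤ 4 → ∣ δ′ ∣ ℕ.≤ 4 → δ ≢ + 0 → δ′ ≢ + 0 →
    a j * δ ≈ a k * δ′ → a j ≡ a k [mod p ]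
  good-set-multiples-congruent {a = a} good j k {δ} {δ′} δ≤4 δ′≤4 δ≢0 δ′≢0 a[j]δ≈a[k]δ′ =
    proj₁ (proj₂ (good j k j δ (- δ′) (+ 0) δ≤4 -δ′≤4 z≤n relation)) δ≢0 -δ′≢0
    where
    -δ′≤4 : ∣ - δ′ ∣ ℕ.≤ 4
    -δ′≤4 = subst (ℕ._≤ 4) (sym (∣-i∣≡∣i∣ δ′)) δ′≤4
    -δ′≢0 : - δ′ ≢ + 0
    -δ′≢0 -δ′≡0 = δ′≢0 (neg-injective -δ′≡0)
    combination : ℤ
    combination = δ * a j + - δ′ * a k + + 0 * a j
    identity : ∀ x y δ δ′ → x * δ - y * δ′ ≡ (δ * x + - δ′ * y + + 0 * x) - + 0
    identity = solve-∀
    relation : combination ≡ + 0 [mod p ]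
    relation = to-mod combination (+ 0)
                 (divides-rearranged (identity (a j) (a k) δ δ′) (divides a[j]δ≈a[k]δ′))

corollary3p3 : (p : ℕ) → Prime p → (q : ℕ) → (a : Fin q → ℤ) →
    (∀ j → (+ 1 ≤ a j) × (a j < + p)) →
    (∀ j k → j ≢ k → ¬ (a j ≡ a k [mod p ])) →
    GoodSet p q a →
    ∀ (j k : Fin q) → j ≢ k → ∀ (u v : ℤ) →
    ¬ (EdgeG p (a j) u v × EdgeG p (a k) u v)
corollary3p3 p _ q a _ distinct good j k j≢k u v (edge-j , edge-k) =
  let δ , δ≤4 , δ≢0 , u-v≈a[j]δ = edgeG-difference (a j) u v edge-j
      δ′ , δ′≤4 , δ′≢0 , u-v≈a[k]δ′ = edgeG-difference (a k) u v edge-k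
  in distinct j k j≢k (good-set-multiples-congruent good j k δ≤4 δ′≤4 δ≢0 δ′≢0
                         (≈-trans (≈-sym u-v≈a[j]δ) u-v≈a[k]δ′))
  where open Congruence p
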